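{- Let $D$ be a finite connected digraph with $\chi(D)=5$, not isomorphic to $T_5$, in which every vertex has out-degree at least $2$, such that $D$ contains no copy of $p_4$ and the underlying graph of $D$ contains no $K_5$. If $v$ and $v'$ are vertices of $D$ such that there exist two adjacent vertices $x,y\in N^+(v)\cap N^-(v')$, then $N^+(v)=\{x,y\}$.
   Context: A digraph has no loops and, for any two vertices $x,y$, at most one of the arcs $(x,y),(y,x)$; $\chi$ is the chromatic number of the underlying (unoriented) graph. $N^+(u)$, $N^-(u)$ denote the out- and in-neighborhoods of $u$ in $D$. $T_5$ is the $5$-vertex tournament in which every vertex has in- and out-degree $2$. $p_4$ is the digraph with vertices $x,y,z,v,w$ and arcs $y\to x$, $y\to z$, $v\to z$, $v\to w$; a copy of $H$ in $D$ is the image of an injective arc-preserving map $V(H)\to V(D)$. -}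

module Defs where

open import Data.Nat using (ℕ; zero; suc; _≤_; _<_)
open import Data.Fin using (Fin; zero; suc)
open import Data.Bool using (Bool; true; false)
open import Data.List using (List; length; filterᵇ; allFin)
open import Data.Product using (Σ; _×_; _,_; ∃-syntax)
open import Data.Sum using (_⊎_)
open import Relation.Nullary using (¬_)
open import Relation.Binary.PropositionalEquality using (_≡_; _≢_)
open import Function.Definitions using (Injective)

record Digraph : Set where
  field
    n     : ℕ
    arc   : Fin n → Fin n → Bool
    loopless : ∀ x → arc x x ≡ false
    asym     : ∀ x y → arc x y ≡ true → arc y x ≡ false

open Digraph public

V : Digraph → Set
V D = Fin (n D)

Arc : (D : Digraph) → V D → V D → Set
Arc D x y = arc D x y ≡ true

Adj : (D : Digraph) → V D → V D → Set
Adj D x y = Arc D x y ⊎ Arc D y x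

outdeg : (D : Digraph) → V D → ℕ
outdeg D u = length (filterᵇ (arc D u) (allFin (n D)))

data Reach (D : Digraph) (u : V D) : V D → Set where
  here : Reach D u u
  step : ∀ {w w'} → Reach D u w → Adj D w w' → Reach D u w'

Connected : Digraph → Set
Connected D = ∀ u w → Reach D u w

Colourable : Digraph → ℕ → Set
Colourable D k = Σ (V D → Fin k) λ c → ∀ u w → Adj D u w → c u ≢ c w

HasChromaticNumber : Digraph → ℕ → Set
HasChromaticNumber D k = Colourable D k × (∀ j → j < k → ¬ Colourable D j)

Isomorphic : Digraph → Digraph → Set
Isomorphic D E =
  Σ (V D → V E) λ f → Σ (V E → V D) λ g →
    (∀ x → g (f x) ≡ x) × (∀ y → f (g y) ≡ y) ×
    (∀ x y → arc E (f x) (f y) ≡ arc D x y)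

HasCopy : Digraph → Digraph → Set
HasCopy H D = Σ (V H → V D) λ h → Injective _≡_ _≡_ h × (∀ x y → Arc H x y → Arc D (h x) (h y))

HasK5 : Digraph → Set
HasK5 D = Σ (Fin 5 → V D) λ h → Injective _≡_ _≡_ h × (∀ i j → i ≢ j → Adj D (h i) (h j))

-- T5 : vertices 0..4, i → j iff j ≡ i+1 or i+2 (mod 5)
t5arc : Fin 5 → Fin 5 → Bool
t5arc zero (suc zero) = true
t5arc zero (suc (suc zero)) = true
t5arc (suc zero) (suc (suc zero)) = true
t5arc (suc zero) (suc (suc (suc zero))) = true
t5arc (suc (suc zero)) (suc (suc (suc zero))) = true
t5arc (suc (suc zero)) (suc (suc (suc (suc zero)))) = true
t5arc (suc (suc (suc zero))) (suc (suc (suc (suc zero)))) = true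
t5arc (suc (suc (suc zero))) zero = true
t5arc (suc (suc (suc (suc zero)))) zero = true
t5arc (suc (suc (suc (suc zero)))) (suc zero) = true
t5arc _ _ = false

T5 : Digraph
T5 = record { n = 5 ; arc = t5arc ; loopless = ll ; asym = as }
  where
  ll : ∀ x → t5arc x x ≡ false
  ll zero = _≡_.refl
  ll (suc zero) = _≡_.refl
  ll (suc (suc zero)) = _≡_.refl
  ll (suc (suc (suc zero))) = _≡_.refl
  ll (suc (suc (suc (suc zero)))) = _≡_.refl
  as : ∀ x y → t5arc x y ≡ true → t5arc y x ≡ false
  as zero (suc zero) _ = _≡_.refl
  as zero (suc (suc zero)) _ = _≡_.refl
  as (suc zero) (suc (suc zero)) _ = _≡_.refl
  as (suc zero) (suc (suc (suc zero))) _ = _≡_.refl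
  as (suc (suc zero)) (suc (suc (suc zero))) _ = _≡_.refl
  as (suc (suc zero)) (suc (suc (suc (suc zero)))) _ = _≡_.refl
  as (suc (suc (suc zero))) (suc (suc (suc (suc zero)))) _ = _≡_.refl
  as (suc (suc (suc zero))) zero _ = _≡_.refl
  as (suc (suc (suc (suc zero)))) zero _ = _≡_.refl
  as (suc (suc (suc (suc zero)))) (suc zero) _ = _≡_.refl
  as zero zero ()
  as zero (suc (suc (suc zero))) ()
  as zero (suc (suc (suc (suc zero)))) ()
  as (suc zero) zero ()
  as (suc zero) (suc zero) ()
  as (suc zero) (suc (suc (suc (suc zero)))) ()
  as (suc (suc zero)) zero ()
  as (suc (suc zero)) (suc zero) ()
  as (suc (suc zero)) (suc (suc zero)) ()
  as (suc (suc (suc zero))) (suc zero) ()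
  as (suc (suc (suc zero))) (suc (suc zero)) ()
  as (suc (suc (suc zero))) (suc (suc (suc zero))) ()
  as (suc (suc (suc (suc zero)))) (suc (suc zero)) ()
  as (suc (suc (suc (suc zero)))) (suc (suc (suc zero))) ()
  as (suc (suc (suc (suc zero)))) (suc (suc (suc (suc zero)))) ()

-- p4 : x=0, y=1, z=2, v=3, w=4 ; arcs y→x, y→z, v→z, v→w
p4arc : Fin 5 → Fin 5 → Bool
p4arc (suc zero) zero = true
p4arc (suc zero) (suc (suc zero)) = true
p4arc (suc (suc (suc zero))) (suc (suc zero)) = true
p4arc (suc (suc (suc zero))) (suc (suc (suc (suc zero)))) = true
p4arc _ _ = false

p4 : Digraph
p4 = record { n = 5 ; arc = p4arc ; loopless = ll ; asym = as }
  where
  ll : ∀ x → p4arc x x ≡ false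
  ll zero = _≡_.refl
  ll (suc zero) = _≡_.refl
  ll (suc (suc zero)) = _≡_.refl
  ll (suc (suc (suc zero))) = _≡_.refl
  ll (suc (suc (suc (suc zero)))) = _≡_.refl
  as : ∀ x y → p4arc x y ≡ true → p4arc y x ≡ false
  as (suc zero) zero _ = _≡_.refl
  as (suc zero) (suc (suc zero)) _ = _≡_.refl
  as (suc (suc (suc zero))) (suc (suc zero)) _ = _≡_.refl
  as (suc (suc (suc zero))) (suc (suc (suc (suc zero)))) _ = _≡_.refl
  as zero _ ()
  as (suc zero) (suc zero) ()
  as (suc zero) (suc (suc (suc _))) ()
  as (suc (suc zero)) _ ()
  as (suc (suc (suc zero))) zero ()
  as (suc (suc (suc zero))) (suc zero) ()
  as (suc (suc (suc zero))) (suc (suc (suc zero))) ()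
  as (suc (suc (suc (suc zero)))) _ ()

-- Suppose x → y (the case y → x is symmetric) and v has a third out-neighbour u.
-- If u ≠ v', then v → u, v → y together with x → y, x → v' form a p4.
-- If u = v', then y has an out-neighbour b ≠ v' (out-degree ≥ 2), and
-- v → x, v → v' together with y → v', y → b form a p4.
module Submission where

open import Defs
open import Data.Nat using (_≤_)
open import Data.Sum using (_⊎_)
open import Data.Product using (_×_)
open import Relation.Nullary using (¬_)
open import Relation.Binary.PropositionalEquality using (_≡_)
open import Function.Bundles using (_⇔_)

open import Data.Nat using (z≤n; s≤s)
open import Data.Nat.Properties using (≤-trans; <-irrefl)
open import Data.Fin using (zero; suc; _≟_)
open import Data.Fin.Properties using (any?)
open import Data.Bool using (T?)
open import Data.Bool.Properties using (T-≡) renaming (_≟_ to _≟ᵇ_)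
open import Data.Empty using (⊥; ⊥-elim)
open import Data.Product using (_,_; ∃-syntax)
open import Data.Sum using (inj₁; inj₂)
open import Data.List using (List; length; filter; allFin)
open import Data.List.Relation.Unary.All as All using (All; []; _∷_)
open import Data.List.Relation.Unary.All.Properties using (all-filter)
open import Data.List.Relation.Unary.AllPairs using ([]; _∷_)
open import Data.List.Relation.Unary.Unique.Propositional using (Unique)
open import Data.List.Relation.Unary.Unique.Propositional.Properties using (allFin⁺; filter⁺)
open import Data.Vec using (Vec; lookup) renaming ([] to []ᵥ; _∷_ to _∷ᵥ_)
open import Data.Vec.Relation.Unary.All using ([]; _∷_)
open import Data.Vec.Relation.Unary.AllPairs using ([]; _∷_)
import Data.Vec.Relation.Unary.Unique.Propositional as Uniqueᵥ
open import Data.Vec.Relation.Unary.Unique.Propositional.Properties using (lookup-injective)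
open import Relation.Nullary using (yes; no; ¬?; contradiction)
open import Relation.Nullary.Decidable using (_×-dec_; decidable-stable)
open import Relation.Binary.PropositionalEquality using (_≢_; refl; sym; trans; ≢-sym)
open import Function using (_∘_)
open import Function.Bundles using (mk⇔; Equivalence)

length≤1 : ∀ {A : Set} {b : A} {xs : List A} → Unique xs → All (_≡ b) xs → length xs ≤ 1
length≤1 _ [] = z≤n
length≤1 _ (_ ∷ []) = s≤s z≤n
length≤1 ((x≢y ∷ _) ∷ _) (x≡b ∷ y≡b ∷ _) = contradiction (trans x≡b (sym y≡b)) x≢y

module _ (D : Digraph) where

  arc⇒≢ : ∀ {a b} → Arc D a b → a ≢ b
  arc⇒≢ {a} ab refl = contradiction (trans (sym ab) (loopless D a)) λ ()

  arc-arc⇒≢ : ∀ {a b c} → Arc D a b → Arc D b c → a ≢ c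
  arc-arc⇒≢ {a} {b} ab bc refl = contradiction (trans (sym bc) (asym D a b ab)) λ ()

  outdeg≤1 : ∀ u b → (∀ w → Arc D u w → w ≡ b) → outdeg D u ≤ 1
  outdeg≤1 u b only-b = length≤1
    (filter⁺ (T? ∘ arc D u) (allFin⁺ (n D)))
    (All.map (λ {w} t → only-b w (Equivalence.to T-≡ t)) (all-filter (T? ∘ arc D u) (allFin (n D))))

  out-neighbour-≢ : ∀ u b → 2 ≤ outdeg D u → ∃[ w ] Arc D u w × w ≢ b
  out-neighbour-≢ u b deg with any? (λ w → (arc D u w ≟ᵇ _) ×-dec ¬? (w ≟ b))
  ... | yes found = found
  ... | no none = contradiction (≤-trans deg (outdeg≤1 u b only-b)) (<-irrefl refl)
    where
    only-b : ∀ w → Arc D u w → w ≡ b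
    only-b w uw = decidable-stable (w ≟ b) (λ w≢b → none (w , uw , w≢b))

  p4-copy : ∀ {x y z v w} → Arc D y x → Arc D y z → Arc D v z → Arc D v w →
    Uniqueᵥ.Unique (x ∷ᵥ y ∷ᵥ z ∷ᵥ v ∷ᵥ w ∷ᵥ []ᵥ) → HasCopy p4 D
  p4-copy {x} {y} {z} {v} {w} yx yz vz vw distinct =
    lookup vertices , lookup-injective distinct _ _ , preserves
    where
    vertices : Vec (V D) 5
    vertices = x ∷ᵥ y ∷ᵥ z ∷ᵥ v ∷ᵥ w ∷ᵥ []ᵥ
    preserves : ∀ i j → Arc p4 i j → Arc D (lookup vertices i) (lookup vertices j)
    preserves (suc zero) zero _ = yx
    preserves (suc zero) (suc (suc zero)) _ = yz
    preserves (suc (suc (suc zero))) (suc (suc zero)) _ = vz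
    preserves (suc (suc (suc zero))) (suc (suc (suc (suc zero)))) _ = vw
    preserves zero _ ()
    preserves (suc zero) (suc zero) ()
    preserves (suc zero) (suc (suc (suc _))) ()
    preserves (suc (suc zero)) _ ()
    preserves (suc (suc (suc zero))) zero ()
    preserves (suc (suc (suc zero))) (suc zero) ()
    preserves (suc (suc (suc zero))) (suc (suc (suc zero))) ()
    preserves (suc (suc (suc (suc zero)))) _ ()

  no-third-out-neighbour : ∀ {v v' x y u} → ¬ HasCopy p4 D → 2 ≤ outdeg D y →
    Arc D v x → Arc D x v' → Arc D v y → Arc D y v' → Arc D x y →
    Arc D v u → u ≢ x → u ≢ y → ⊥
  no-third-out-neighbour {v' = v'} {u = u} p4-free deg vx xv' vy yv' xy vu u≢x u≢y with u ≟ v'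
  ... | no u≢v' = p4-free (p4-copy vu vy xy xv'
    ( (≢-sym (arc⇒≢ vu) ∷ u≢y ∷ u≢x ∷ u≢v' ∷ [])
    ∷ (arc⇒≢ vy ∷ arc⇒≢ vx ∷ arc-arc⇒≢ vx xv' ∷ [])
    ∷ (≢-sym (arc⇒≢ xy) ∷ arc⇒≢ yv' ∷ [])
    ∷ (arc⇒≢ xv' ∷ [])
    ∷ [] ∷ []))
  ... | yes refl with out-neighbour-≢ _ v' deg
  ... | b , yb , b≢v' = p4-free (p4-copy vx vu yv' yb
    ( (≢-sym (arc⇒≢ vx) ∷ arc⇒≢ xv' ∷ arc⇒≢ xy ∷ arc-arc⇒≢ xy yb ∷ [])
    ∷ (arc-arc⇒≢ vx xv' ∷ arc⇒≢ vy ∷ arc-arc⇒≢ vy yb ∷ [])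
    ∷ (≢-sym (arc⇒≢ yv') ∷ ≢-sym b≢v' ∷ [])
    ∷ (arc⇒≢ yb ∷ [])
    ∷ [] ∷ []))

lemma2p11 : (D : Digraph) → Connected D → HasChromaticNumber D 5 → ¬ Isomorphic D T5
    → (∀ u → 2 ≤ outdeg D u) → ¬ HasCopy p4 D → ¬ HasK5 D
    → (v v' x y : V D) → Arc D v x → Arc D x v' → Arc D v y → Arc D y v' → Adj D x y
    → ∀ u → Arc D v u ⇔ (u ≡ x ⊎ u ≡ y)
lemma2p11 D _ _ _ deg p4-free _ v v' x y vx xv' vy yv' x~y u = mk⇔ to from
  where
  from : u ≡ x ⊎ u ≡ y → Arc D v u
  from (inj₁ refl) = vx
  from (inj₂ refl) = vy
  no-third : Adj D x y → Arc D v u → u ≢ x → u ≢ y → ⊥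
  no-third (inj₁ xy) vu u≢x u≢y = no-third-out-neighbour D p4-free (deg y) vx xv' vy yv' xy vu u≢x u≢y
  no-third (inj₂ yx) vu u≢x u≢y = no-third-out-neighbour D p4-free (deg x) vy yv' vx xv' yx vu u≢y u≢x
  to : Arc D v u → u ≡ x ⊎ u ≡ y
  to vu with u ≟ x | u ≟ y
  ... | yes u≡x | _       = inj₁ u≡x
  ... | no _    | yes u≡y = inj₂ u≡y
  ... | no u≢x  | no u≢y  = ⊥-elim (no-third x~y vu u≢x u≢y)
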